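{- Let $a,b,c$ be positive integers. Every $\pi\in\mathcal{D}_{(a,b,c)}$ can be written uniquely as $$\pi=S^{a}W^{\ell_1}S^{b}W^{\ell_2}S^{c}W^{a+b+c-\ell_1-\ell_2}$$ with integers $0\le\ell_1\le a$, $\ell_2\ge0$, $\ell_1+\ell_2\le a+b$ (here $W^m$ denotes $m$ consecutive letters $W$). Define $\theta$ on $\mathcal{D}_{(a,b,c)}$ by $$\theta(\pi)=\begin{cases}S^{a}W^{a-\ell_1}S^{b}W^{b-\ell_2}S^{c}W^{c+\ell_1+\ell_2}, & \text{if } \ell_2\le b,\\ S^{a}W^{a+b-\ell_1-\ell_2}S^{b}W^{\ell_2}S^{c}W^{c+\ell_1}, & \text{otherwise.}\end{cases}$$ Then $\theta$ is an involution on $\mathcal{D}_{(a,b,c)}$ satisfying $\mathrm{area}(\pi)=\mathrm{depth}(\theta(\pi))$ and $\mathrm{depth}(\pi)=\mathrm{area}(\theta(\pi))$ for all $\pi\in\mathcal{D}_{(a,b,c)}$.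
   Context: For a vector $\vec{k}=(k_1,\dots,k_\ell)$ of positive integers, $N=|\vec k|+\ell$. A $\vec{k}$-Dyck path is a word $\pi=\pi_1\cdots\pi_N$ consisting of the letters $S^{k_1},\dots,S^{k_\ell}$, each exactly once and in this order from left to right, together with $|\vec k|$ letters $W$, such that the starting ranks $r_1=0$, $r_{i+1}=r_i+k_j$ if $\pi_i=S^{k_j}$, $r_{i+1}=r_i-1$ if $\pi_i=W$, are all nonnegative. $\mathcal{D}_{\vec k}$ is the set of $\vec k$-Dyck paths. The area sequence is $(a_1,\dots,a_\ell)$ with $a_j=r_i$ where $\pi_i=S^{k_j}$; $\mathrm{area}(\pi)=\sum_j a_j$. Filling algorithm $\eta_*$: in a tableau of $\ell$ top-justified columns, column $i$ with $k_i+1$ cells, place $1,\dots,N$ successively: $1$ at the top of column 1; for $i\ge2$, if $\pi_i$ is an $S$-letter put $i$ at the top of the leftmost empty column, and if $\pi_i=W$ put $i$ immediately below the largest active entry (an entry is active if it is currently the bottom-most entry of its column $j$ and that column has fewer than $k_j+1$ entries). Ranking: column 1 gets ranks $0,1,\dots,k_1$ top to bottom; for $i\ge2$, if the top entry of column $i$ is $A+1$ and $A$ has rank $\alpha$, column $i$ gets ranks $\alpha,\dots,\alpha+k_i$ top to bottom. $\mathrm{depth}(\pi)$ is the sum of the ranks of the first-row cells of $\eta_*(\pi)$. -}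

module Defs where

open import Data.Nat using (ℕ; zero; suc; _+_; _∸_; _<ᵇ_; _≤ᵇ_; _≡ᵇ_)
open import Data.List using (List; []; _∷_; _++_; [_]; replicate; length; map)
open import Data.Nat.ListAction using (sum)
open import Data.Maybe using (Maybe; just; nothing; fromMaybe; maybe)
open import Data.Product using (_×_; _,_)
open import Data.Bool using (Bool; true; false; if_then_else_; _∧_)
open import Data.Unit using (⊤)
open import Data.Empty using (⊥)
open import Relation.Binary.PropositionalEquality using (_≡_)

-- Letters and words.  `S k` is the letter S^k; the j-th S-letter of a
-- word is the letter S^{k_j}.

data Letter : Set where
  S : ℕ → Letter
  W : Letter

Ws : ℕ → List Letter
Ws m = replicate m W

sLetters : List Letter → List ℕ
sLetters []        = []
sLetters (S k ∷ w) = k ∷ sLetters w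
sLetters (W ∷ w)   = sLetters w

countW : List Letter → ℕ
countW []        = 0
countW (S _ ∷ w) = countW w
countW (W ∷ w)   = suc (countW w)

Nonneg : ℕ → List Letter → Set
Nonneg r       []        = ⊤
Nonneg r       (S k ∷ w) = Nonneg (r + k) w
Nonneg zero    (W ∷ w)   = ⊥
Nonneg (suc r) (W ∷ w)   = Nonneg r w

-- π ∈ 𝒟_k : the S-letters are S^{k_1},…,S^{k_ℓ} in this order, there are
-- |k| letters W, and all ranks are nonnegative (starting from r_1 = 0).
record Dyck (k : List ℕ) (π : List Letter) : Set where
  constructor dyck
  field
    sOrder  : sLetters π ≡ k
    wCount  : countW π ≡ sum k
    ranksOK : Nonneg 0 π

areaFrom : ℕ → List Letter → ℕ
areaFrom r []        = 0
areaFrom r (S k ∷ w) = r + areaFrom (r + k) w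
areaFrom r (W ∷ w)   = areaFrom (r ∸ 1) w

area : List Letter → ℕ
area π = areaFrom 0 π

-- A tableau is a list of columns (left to right); a column is a pair
-- (number of cells = k_j + 1 , entries from top to bottom).
-- Columns are created when their S-letter is read; since the S-letters
-- occur in the order S^{k_1},…,S^{k_ℓ}, "the leftmost empty column" is
-- exactly the next column to be created.

Column : Set
Column = ℕ × List ℕ

lastEntry : List ℕ → Maybe ℕ
lastEntry []       = nothing
lastEntry (x ∷ []) = just x
lastEntry (x ∷ xs) = lastEntry xs

-- bottom-most entry of the column if the column is active, 0 otherwise
-- (all entries are ≥ 1)
activeBottom : Column → ℕ
activeBottom (cap , es) =
  if length es <ᵇ cap then fromMaybe 0 (lastEntry es) else 0

maxActive : List Column → ℕ
maxActive []       = 0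
maxActive (c ∷ cs) = let m = activeBottom c ; n = maxActive cs in
  if m <ᵇ n then n else m

putBelow : ℕ → ℕ → List Column → List Column
putBelow m i [] = []
putBelow m i ((cap , es) ∷ cs) =
  if (1 ≤ᵇ m) ∧ (activeBottom (cap , es) ≡ᵇ m)
  then (cap , es ++ [ i ]) ∷ cs
  else (cap , es) ∷ putBelow m i cs

fillFrom : ℕ → List Letter → List Column → List Column
fillFrom i []        T = T
fillFrom i (S k ∷ w) T = fillFrom (suc i) w (T ++ [ (suc k , [ i ]) ])
fillFrom i (W ∷ w)   T = fillFrom (suc i) w (putBelow (maxActive T) i T)

-- η_*(π), letters numbered 1,…,N
fill : List Letter → List Column
fill π = fillFrom 1 π []

posIn : ℕ → List ℕ → Maybe ℕ
posIn x []       = nothing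
posIn x (y ∷ ys) = if x ≡ᵇ y then just 0 else Data.Maybe.map suc (posIn x ys)

-- rank of entry x among already ranked columns (entries , rank of top cell)
rankIn : ℕ → List (List ℕ × ℕ) → Maybe ℕ
rankIn x []              = nothing
rankIn x ((es , r) ∷ cs) = maybe (λ p → just (r + p)) (rankIn x cs) (posIn x es)

topEntry : List ℕ → ℕ
topEntry []      = 0
topEntry (x ∷ _) = x

-- ranks of the top cells: column 1 starts at rank 0; column i ≥ 2 with top
-- entry A+1 starts at the rank α of A.
topRanksFrom : List (List ℕ × ℕ) → List Column → List ℕ
topRanksFrom done [] = []
topRanksFrom [] ((_ , es) ∷ cs) = 0 ∷ topRanksFrom [ (es , 0) ] cs
topRanksFrom (d ∷ ds) ((_ , es) ∷ cs) =
  let r = fromMaybe 0 (rankIn (topEntry es ∸ 1) (d ∷ ds))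
  in r ∷ topRanksFrom ((d ∷ ds) ++ [ (es , r) ]) cs

depth : List Letter → ℕ
depth π = sum (topRanksFrom [] (fill π))

word3 : ℕ → ℕ → ℕ → ℕ → ℕ → ℕ → List Letter
word3 a b c l1 l2 l3 = S a ∷ Ws l1 ++ S b ∷ Ws l2 ++ S c ∷ Ws l3

gapsFrom : Maybe ℕ → List Letter → List ℕ
gapsFrom nothing  []        = []
gapsFrom (just n) []        = n ∷ []
gapsFrom m        (W ∷ w)   = gapsFrom (Data.Maybe.map suc m) w
gapsFrom nothing  (S _ ∷ w) = gapsFrom (just 0) w
gapsFrom (just n) (S _ ∷ w) = n ∷ gapsFrom (just 0) w

gaps : List Letter → List ℕ
gaps π = gapsFrom nothing π

-- θ on 𝒟_(a,b,c): ℓ1, ℓ2 are read off π as the W-runs after S^a and S^b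
-- (for π = S^a W^{ℓ1} S^b W^{ℓ2} S^c W^{…} these are exactly ℓ1, ℓ2).
-- The value on words not of this shape is irrelevant.
θ : ℕ → ℕ → ℕ → List Letter → List Letter
θ a b c π with gaps π
... | l1 ∷ l2 ∷ _ =
  if l2 ≤ᵇ b
  then word3 a b c (a ∸ l1) (b ∸ l2) (c + l1 + l2)
  else word3 a b c (a + b ∸ l1 ∸ l2) l2 (c + l1)
... | _ = π

{-# OPTIONS --safe #-}
module Submission where

-- Write π = S^a W^x S^b W^y S^c W^z.  The ranks at which S^b and S^c start are
-- p = a − x and q = p + b − y, so area π = p + q.  In the filling, the first x
-- letters W go below 1 in column 1 and the next ones below the top of column 2;
-- once column 2 is full (y > b) the remaining y − b go back to column 1.  The
-- letters W after S^c only append labels larger than every top entry, so they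
-- do not affect the ranking, and depth π = x + (x + y) if y ≤ b and
-- x + (x + (y − b)) otherwise.  With x' = a − x, y' = b − y in the first case
-- and u = a + b − x − y in the second, π and θ π are exchanged by x ↔ x', y ↔ y'
-- resp. x ↔ u, which swaps the two formulas.

open import Defs
open import Data.Bool using (T; true; false; if_then_else_; _∧_)
open import Data.Bool.Properties using (T-∧)
open import Data.Empty using (⊥; ⊥-elim)
open import Data.List using (List; []; _∷_; _++_; [_]; length)
open import Data.List.Properties using (++-assoc; ++-identityʳ; length-++; ∷-injectiveʳ)
open import Data.List.Membership.Propositional using (_∈_; _∉_)
open import Data.List.Relation.Binary.Pointwise as Pointwise using (Pointwise; []; _∷_)
open import Data.List.Relation.Unary.All as All using (All; []; _∷_)
open import Data.List.Relation.Unary.All.Properties using (++⁺)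
open import Data.List.Relation.Unary.Any using (here; there)
open import Data.Maybe as Maybe using (just; nothing; fromMaybe; maybe)
open import Data.Maybe.Properties using (map-id; map-∘)
open import Data.Nat
open import Data.Nat.ListAction using (sum)
open import Data.Nat.Properties
open import Data.Nat.Tactic.RingSolver using (solve-∀)
open import Data.Product using (_×_; _,_; ∃-syntax; ∃!; proj₁; proj₂)
import Data.Product.Relation.Binary.Pointwise.NonDependent as ×
open import Data.Unit using (tt)
open import Function using (_∘_)
open import Function.Bundles using (Equivalence)
open import Relation.Binary.PropositionalEquality hiding ([_])
open import Relation.Nullary using (¬_; yes; no)

if-T : ∀ {A : Set} {b} {x y : A} → T b → (if b then x else y) ≡ x
if-T {b = true} _ = refl

if-¬T : ∀ {A : Set} {b} {x y : A} → ¬ T b → (if b then x else y) ≡ y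
if-¬T {b = false} _  = refl
if-¬T {b = true}  ¬t = ⊥-elim (¬t tt)

Ws-+ : ∀ m n w → Ws (m + n) ++ w ≡ Ws m ++ Ws n ++ w
Ws-+ zero    n w = refl
Ws-+ (suc m) n w = cong (W ∷_) (Ws-+ m n w)

sLetters-Ws : ∀ m w → sLetters (Ws m ++ w) ≡ sLetters w
sLetters-Ws zero    w = refl
sLetters-Ws (suc m) w = sLetters-Ws m w

countW-Ws : ∀ m w → countW (Ws m ++ w) ≡ m + countW w
countW-Ws zero    w = refl
countW-Ws (suc m) w = cong suc (countW-Ws m w)

Nonneg-Ws⁺ : ∀ m {r} w → Nonneg r w → Nonneg (m + r) (Ws m ++ w)
Nonneg-Ws⁺ zero    w nn = nn
Nonneg-Ws⁺ (suc m) w nn = Nonneg-Ws⁺ m w nn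

Nonneg-Ws⁻ : ∀ m {r} w → Nonneg r (Ws m ++ w) → ∃[ r' ] r ≡ m + r' × Nonneg r' w
Nonneg-Ws⁻ zero    {r}     w nn = r , refl , nn
Nonneg-Ws⁻ (suc m) {suc r} w nn with Nonneg-Ws⁻ m w nn
... | r' , refl , nn' = r' , refl , nn'

areaFrom-Ws : ∀ m r w → areaFrom (m + r) (Ws m ++ w) ≡ areaFrom r w
areaFrom-Ws zero    r w = refl
areaFrom-Ws (suc m) r w = areaFrom-Ws m r w

Nonneg-Ws-end : ∀ m → Nonneg m (Ws m)
Nonneg-Ws-end zero    = tt
Nonneg-Ws-end (suc m) = Nonneg-Ws-end m

areaFrom-Ws-end : ∀ m r → areaFrom r (Ws m) ≡ 0
areaFrom-Ws-end zero    r = refl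
areaFrom-Ws-end (suc m) r = areaFrom-Ws-end m (r ∸ 1)

gapsFrom-Ws : ∀ m n w → gapsFrom (just n) (Ws m ++ w) ≡ gapsFrom (just (n + m)) w
gapsFrom-Ws zero    n w = cong (λ k → gapsFrom (just k) w) (sym (+-identityʳ n))
gapsFrom-Ws (suc m) n w = trans (gapsFrom-Ws m (suc n) w) (cong (λ k → gapsFrom (just k) w) (sym (+-suc n m)))

split-at-S : ∀ w {k ks} → sLetters w ≡ k ∷ ks →
  ∃[ n ] ∃[ w' ] w ≡ Ws n ++ S k ∷ w' × sLetters w' ≡ ks
split-at-S (S _ ∷ w) refl = 0 , w , refl , refl
split-at-S (W ∷ w)   eq with split-at-S w eq
... | n , w' , refl , eq' = suc n , w' , refl , eq'

no-S⇒Ws : ∀ w → sLetters w ≡ [] → w ≡ Ws (countW w)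
no-S⇒Ws []      _  = refl
no-S⇒Ws (W ∷ w) eq = cong (W ∷_) (no-S⇒Ws w eq)

Ws-S-injective : ∀ m n {k k' w w'} → Ws m ++ S k ∷ w ≡ Ws n ++ S k' ∷ w' → m ≡ n × w ≡ w'
Ws-S-injective zero    zero    eq = refl , ∷-injectiveʳ eq
Ws-S-injective (suc m) (suc n) eq with Ws-S-injective m n (∷-injectiveʳ eq)
... | refl , w≡w' = refl , w≡w'

word3-injective : ∀ {a b c x y z x' y' z'} → word3 a b c x y z ≡ word3 a b c x' y' z' → x ≡ x' × y ≡ y'
word3-injective {x = x} {y} {x' = x'} {y'} eq with Ws-S-injective x x' (∷-injectiveʳ eq)
... | refl , eq' with Ws-S-injective y y' eq'
... | refl , _ = refl , refl

-- p and q are the ranks at which S^b and S^c start.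
word3⇒dyck : ∀ {a b c x y z p q} → x + p ≡ a → y + q ≡ p + b → z ≡ q + c →
  Dyck (a ∷ b ∷ c ∷ []) (word3 a b c x y z)
word3⇒dyck {a} {b} {c} {x} {y} {z} {p} {q} refl y+q≡p+b refl = dyck letters count ranks
  where
  tail : List Letter
  tail = S c ∷ Ws (q + c)
  letters : sLetters (word3 (x + p) b c x y (q + c)) ≡ x + p ∷ b ∷ c ∷ []
  letters rewrite sLetters-Ws x (S b ∷ Ws y ++ tail) | sLetters-Ws y tail
                | sym (++-identityʳ (Ws (q + c))) | sLetters-Ws (q + c) [] = refl
  count : countW (word3 (x + p) b c x y (q + c)) ≡ sum (x + p ∷ b ∷ c ∷ [])
  count rewrite countW-Ws x (S b ∷ Ws y ++ tail) | countW-Ws y tail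
              | sym (++-identityʳ (Ws (q + c))) | countW-Ws (q + c) [] = begin
    x + (y + (q + c + 0))   ≡⟨ cong (x +_) (reassoc y q c) ⟩
    x + (y + q + c)         ≡⟨ cong (λ n → x + (n + c)) y+q≡p+b ⟩
    x + (p + b + c)         ≡⟨ reassoc' x p b c ⟩
    x + p + (b + (c + 0))   ∎
    where
    open ≡-Reasoning
    reassoc : ∀ y q c → y + (q + c + 0) ≡ y + q + c
    reassoc = solve-∀
    reassoc' : ∀ x p b c → x + (p + b + c) ≡ x + p + (b + (c + 0))
    reassoc' = solve-∀
  ranks : Nonneg 0 (word3 (x + p) b c x y (q + c))
  ranks = Nonneg-Ws⁺ x _ (subst (λ r → Nonneg r (Ws y ++ tail)) y+q≡p+b
            (Nonneg-Ws⁺ y tail (Nonneg-Ws-end (q + c))))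

dyck⇒word3 : ∀ {a b c π} → Dyck (a ∷ b ∷ c ∷ []) π →
  ∃[ x ] ∃[ y ] ∃[ p ] ∃[ q ] x + p ≡ a × y + q ≡ p + b × π ≡ word3 a b c x y (q + c)
dyck⇒word3 {a} {b} {c} {π} (dyck letters count ranks) with split-at-S π letters
... | suc _ , _  , refl , _  = ⊥-elim ranks
... | zero  , π₁ , refl , s₁ with split-at-S π₁ s₁
... | x     , π₂ , refl , s₂ with split-at-S π₂ s₂
... | y     , π₃ , refl , s₃ with Nonneg-Ws⁻ x _ ranks
... | p     , refl , ranks₂ with Nonneg-Ws⁻ y _ ranks₂
... | q     , p+b≡y+q , _ =
  x , y , p , q , refl , sym p+b≡y+q ,
  cong (λ w → S a ∷ Ws x ++ S b ∷ Ws y ++ S c ∷ w) (trans (no-S⇒Ws π₃ s₃) (cong Ws last-run))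
  where
  last-run : countW π₃ ≡ q + c
  last-run = +-cancelˡ-≡ y _ _ (+-cancelˡ-≡ x _ _ (begin
    x + (y + countW π₃)                     ≡⟨ cong (x +_) (countW-Ws y _) ⟨
    x + countW (Ws y ++ S c ∷ π₃)           ≡⟨ countW-Ws x _ ⟨
    countW (Ws x ++ S b ∷ Ws y ++ S c ∷ π₃) ≡⟨ count ⟩
    x + p + (b + (c + 0))                   ≡⟨ reassoc x p b c ⟩
    x + (p + b + c)                         ≡⟨ cong (λ n → x + (n + c)) p+b≡y+q ⟩
    x + (y + q + c)                         ≡⟨ cong (x +_) (+-assoc y q c) ⟩
    x + (y + (q + c))                       ∎))
    where
    open ≡-Reasoning
    reassoc : ∀ x p b c → x + p + (b + (c + 0)) ≡ x + (p + b + c)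
    reassoc = solve-∀

word3-decomposition-unique : ∀ {a b c π} → Dyck (a ∷ b ∷ c ∷ []) π →
  ∃! _≡_ (λ (l : ℕ × ℕ) →
    proj₁ l ≤ a × proj₁ l + proj₂ l ≤ a + b ×
    π ≡ word3 a b c (proj₁ l) (proj₂ l) (a + b + c ∸ proj₁ l ∸ proj₂ l))
word3-decomposition-unique {b = b} {c} d with dyck⇒word3 d
... | x , y , p , q , refl , y+q≡p+b , refl =
  (x , y) , (m≤m+n x p , x+y≤a+b , cong (word3 (x + p) b c x y) (sym last-run)) , unique
  where
  x+y≤a+b : x + y ≤ x + p + b
  x+y≤a+b = begin
    x + y        ≤⟨ +-monoʳ-≤ x (m≤m+n y q) ⟩
    x + (y + q)  ≡⟨ cong (x +_) y+q≡p+b ⟩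
    x + (p + b)  ≡⟨ +-assoc x p b ⟨
    x + p + b    ∎
    where open ≤-Reasoning
  last-run : x + p + b + c ∸ x ∸ y ≡ q + c
  last-run = begin
    x + p + b + c ∸ x ∸ y       ≡⟨ ∸-+-assoc (x + p + b + c) x y ⟩
    x + p + b + c ∸ (x + y)     ≡⟨ cong (_∸ (x + y)) (reassoc x p b c) ⟩
    x + (p + b) + c ∸ (x + y)   ≡⟨ cong (λ n → x + n + c ∸ (x + y)) y+q≡p+b ⟨
    x + (y + q) + c ∸ (x + y)   ≡⟨ cong (_∸ (x + y)) (reassoc' x y q c) ⟩
    x + y + (q + c) ∸ (x + y)   ≡⟨ m+n∸m≡n (x + y) (q + c) ⟩
    q + c                       ∎
    where
    open ≡-Reasoning
    reassoc : ∀ x p b c → x + p + b + c ≡ x + (p + b) + c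
    reassoc = solve-∀
    reassoc' : ∀ x y q c → x + (y + q) + c ≡ x + y + (q + c)
    reassoc' = solve-∀
  unique : ∀ {l} → proj₁ l ≤ x + p × proj₁ l + proj₂ l ≤ x + p + b ×
    word3 (x + p) b c x y (q + c) ≡ word3 (x + p) b c (proj₁ l) (proj₂ l) (x + p + b + c ∸ proj₁ l ∸ proj₂ l) →
    (x , y) ≡ l
  unique (_ , _ , eq) with word3-injective eq
  ... | refl , refl = refl

data Shape (a b c : ℕ) : List Letter → Set where
  short : ∀ {x x' y y'} → x + x' ≡ a → y + y' ≡ b → Shape a b c (word3 a b c x y (c + x' + y'))
  long  : ∀ {x t u} → x + suc t + u ≡ a → Shape a b c (word3 a b c x (b + suc t) (c + u))

shape : ∀ {a b c π} → Dyck (a ∷ b ∷ c ∷ []) π → Shape a b c π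
shape {a} {b} {c} d with dyck⇒word3 d
... | x , y , p , q , x+p≡a , y+q≡p+b , refl with y ≤? b
... | yes y≤b with m≤n⇒∃[o]m+o≡n y≤b
...   | y' , refl = subst (Shape a (y + y') c ∘ word3 a (y + y') c x y) last-run (short x+p≡a refl)
  where
  last-run : c + p + y' ≡ q + c
  last-run = begin
    c + p + y'   ≡⟨ reassoc c p y' ⟩
    p + y' + c   ≡⟨ cong (_+ c) (+-cancelˡ-≡ y _ _ (trans y+q≡p+b (sym (reassoc' y p y')))) ⟨
    q + c        ∎
    where
    open ≡-Reasoning
    reassoc : ∀ c p y' → c + p + y' ≡ p + y' + c
    reassoc = solve-∀
    reassoc' : ∀ y p y' → y + (p + y') ≡ p + (y + y')
    reassoc' = solve-∀
shape {a} {b} {c} d | x , y , p , q , x+p≡a , y+q≡p+b , refl | no y≰b with m≤n⇒∃[o]m+o≡n (≰⇒> y≰b)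
... | t , refl = subst₂ (λ y z → Shape a b c (word3 a b c x y z)) (+-suc b t) (+-comm c q) (long first-run)
  where
  first-run : x + suc t + q ≡ a
  first-run = begin
    x + suc t + q   ≡⟨ +-assoc x (suc t) q ⟩
    x + (suc t + q) ≡⟨ cong (x +_) (+-cancelʳ-≡ b _ _ (trans (reassoc t q b) y+q≡p+b)) ⟩
    x + p           ≡⟨ x+p≡a ⟩
    a               ∎
    where
    open ≡-Reasoning
    reassoc : ∀ t q b → suc t + q + b ≡ suc b + t + q
    reassoc = solve-∀

area-word3 : ∀ {a b c} x y z {p q} → x + p ≡ a → y + q ≡ p + b → area (word3 a b c x y z) ≡ p + q
area-word3 {b = b} {c} x y z {p} {q} refl y+q≡p+b = begin
  areaFrom (x + p) (Ws x ++ S b ∷ Ws y ++ S c ∷ Ws z)  ≡⟨ areaFrom-Ws x p _ ⟩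
  p + areaFrom (p + b) (Ws y ++ S c ∷ Ws z)           ≡⟨ cong (λ r → p + areaFrom r (Ws y ++ S c ∷ Ws z)) y+q≡p+b ⟨
  p + areaFrom (y + q) (Ws y ++ S c ∷ Ws z)           ≡⟨ cong (p +_) (areaFrom-Ws y q _) ⟩
  p + (q + areaFrom (q + c) (Ws z))                   ≡⟨ cong (λ n → p + (q + n)) (areaFrom-Ws-end z (q + c)) ⟩
  p + (q + 0)                                         ≡⟨ cong (p +_) (+-identityʳ q) ⟩
  p + q                                               ∎
  where open ≡-Reasoning

gaps-word3 : ∀ a b c x y z → gaps (word3 a b c x y z) ≡ x ∷ y ∷ z ∷ []
gaps-word3 a b c x y z
  rewrite gapsFrom-Ws x 0 (S b ∷ Ws y ++ S c ∷ Ws z) | gapsFrom-Ws y 0 (S c ∷ Ws z)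
        | sym (++-identityʳ (Ws z)) | gapsFrom-Ws z 0 [] = refl

θ-word3 : ∀ a b c x y z → θ a b c (word3 a b c x y z) ≡
  (if y ≤ᵇ b then word3 a b c (a ∸ x) (b ∸ y) (c + x + y) else word3 a b c (a + b ∸ x ∸ y) y (c + x))
θ-word3 a b c x y z rewrite gaps-word3 a b c x y z = refl

θ-short : ∀ {a b c x x' y y'} z → x + x' ≡ a → y + y' ≡ b →
  θ a b c (word3 a b c x y z) ≡ word3 a b c x' y' (c + x + y)
θ-short {c = c} {x} {x'} {y} {y'} z refl refl = begin
  θ a b c (word3 a b c x y z)                              ≡⟨ θ-word3 a b c x y z ⟩
  (if y ≤ᵇ b then word3 a b c (a ∸ x) (b ∸ y) (c + x + y)
   else word3 a b c (a + b ∸ x ∸ y) y (c + x))             ≡⟨ if-T (≤⇒≤ᵇ (m≤m+n y y')) ⟩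
  word3 a b c (a ∸ x) (b ∸ y) (c + x + y)
    ≡⟨ cong₂ (λ m n → word3 a b c m n (c + x + y)) (m+n∸m≡n x x') (m+n∸m≡n y y') ⟩
  word3 a b c x' y' (c + x + y)                            ∎
  where
  open ≡-Reasoning
  a b : ℕ
  a = x + x'
  b = y + y'

θ-long : ∀ {a b c x t u} z → x + suc t + u ≡ a →
  θ a b c (word3 a b c x (b + suc t) z) ≡ word3 a b c u (b + suc t) (c + x)
θ-long {b = b} {c} {x} {t} {u} z refl = begin
  θ a b c (word3 a b c x y z)                              ≡⟨ θ-word3 a b c x y z ⟩
  (if y ≤ᵇ b then word3 a b c (a ∸ x) (b ∸ y) (c + x + y)
   else word3 a b c (a + b ∸ x ∸ y) y (c + x))             ≡⟨ if-¬T (λ y≤b → m+1+n≰m b (≤ᵇ⇒≤ y b y≤b)) ⟩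
  word3 a b c (a + b ∸ x ∸ y) y (c + x)                    ≡⟨ cong (λ m → word3 a b c m y (c + x)) first-run ⟩
  word3 a b c u y (c + x)                                  ∎
  where
  open ≡-Reasoning
  a y : ℕ
  a = x + suc t + u
  y = b + suc t
  first-run : a + b ∸ x ∸ y ≡ u
  first-run = begin
    a + b ∸ x ∸ y       ≡⟨ ∸-+-assoc (a + b) x y ⟩
    a + b ∸ (x + y)     ≡⟨ cong (_∸ (x + y)) (reassoc x t u b) ⟩
    x + y + u ∸ (x + y) ≡⟨ m+n∸m≡n (x + y) u ⟩
    u                   ∎
    where
    reassoc : ∀ x t u b → x + suc t + u + b ≡ x + (b + suc t) + u
    reassoc = solve-∀

consecutive : ℕ → ℕ → List ℕ
consecutive s zero    = []
consecutive s (suc n) = s ∷ consecutive (suc s) n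

length-consecutive : ∀ s n → length (consecutive s n) ≡ n
length-consecutive s zero    = refl
length-consecutive s (suc n) = cong suc (length-consecutive (suc s) n)

lastEntry-consecutive : ∀ s n → lastEntry (consecutive s (suc n)) ≡ just (s + n)
lastEntry-consecutive s zero    = cong just (sym (+-identityʳ s))
lastEntry-consecutive s (suc n) = trans (lastEntry-consecutive (suc s) n) (cong just (sym (+-suc s n)))

lastEntry-snoc : ∀ (es : List ℕ) v → lastEntry (es ++ [ v ]) ≡ just v
lastEntry-snoc []           v = refl
lastEntry-snoc (_ ∷ [])     v = refl
lastEntry-snoc (_ ∷ e ∷ es) v = lastEntry-snoc (e ∷ es) v

activeBottom-active : ∀ {cap} es {v} → length es < cap → lastEntry es ≡ just v → activeBottom (cap , es) ≡ v
activeBottom-active _ room last = trans (if-T (<⇒<ᵇ room)) (cong (fromMaybe 0) last)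

activeBottom-full : ∀ {cap} es → cap ≤ length es → activeBottom (cap , es) ≡ 0
activeBottom-full _ full = if-¬T (λ room → ≤⇒≯ full (<ᵇ⇒< _ _ room))

activeBottom-≤ : ∀ cap es {v} → lastEntry es ≡ just v → activeBottom (cap , es) ≤ v
activeBottom-≤ cap es last with length es <ᵇ cap
... | true  = ≤-reflexive (cong (fromMaybe 0) last)
... | false = z≤n

maxActive-≤ : ∀ {v cs} → All (λ col → activeBottom col ≤ v) cs → maxActive cs ≤ v
maxActive-≤ []                    = z≤n
maxActive-≤ {cs = col ∷ cs} (b≤v ∷ bs≤v) with activeBottom col <ᵇ maxActive cs
... | true  = maxActive-≤ bs≤v
... | false = b≤v

maxActive-unique : ∀ {v col} L {R} → All (λ c → activeBottom c < v) L → All (λ c → activeBottom c < v) R →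
  activeBottom col ≡ v → maxActive (L ++ col ∷ R) ≡ v
maxActive-unique []      _          R<v refl = if-¬T (λ lt → <⇒≱ (<ᵇ⇒< _ _ lt) (maxActive-≤ (All.map <⇒≤ R<v)))
maxActive-unique {v} {col} (_ ∷ L) {R} (l<v ∷ L<v) R<v bot =
  trans (if-T (<⇒<ᵇ (subst (_ <_) (sym rest) l<v))) rest
  where
  rest : maxActive (L ++ col ∷ R) ≡ v
  rest = maxActive-unique L L<v R<v bot

putBelow-unique : ∀ {v i cap es} L {R} → All (λ c → activeBottom c < v) L → 0 < v →
  activeBottom (cap , es) ≡ v → putBelow v i (L ++ (cap , es) ∷ R) ≡ L ++ (cap , es ++ [ i ]) ∷ R
putBelow-unique []      _          0<v bot =
  if-T (Equivalence.from T-∧ (≤⇒≤ᵇ 0<v , ≡⇒≡ᵇ _ _ bot))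
putBelow-unique {v} ((cap' , es') ∷ L) (l<v ∷ L<v) 0<v bot =
  trans (if-¬T miss) (cong ((cap' , es') ∷_) (putBelow-unique L L<v 0<v bot))
  where
  miss : ¬ T ((1 ≤ᵇ v) ∧ (activeBottom (cap' , es') ≡ᵇ v))
  miss hit = <⇒≢ l<v (≡ᵇ⇒≡ _ _ (proj₂ (Equivalence.to T-∧ hit)))

fillFrom-Ws-into : ∀ m L {R cap es v i} w →
  All (λ c → activeBottom c < v) L → All (λ c → activeBottom c < v) R →
  lastEntry es ≡ just v → 0 < v → v < i → length es + m ≤ cap →
  fillFrom i (Ws m ++ w) (L ++ (cap , es) ∷ R) ≡ fillFrom (i + m) w (L ++ (cap , es ++ consecutive i m) ∷ R)
fillFrom-Ws-into zero L {R} {cap} {es} {i = i} w _ _ _ _ _ _ =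
  cong₂ (λ j es' → fillFrom j w (L ++ (cap , es') ∷ R)) (sym (+-identityʳ i)) (sym (++-identityʳ es))
fillFrom-Ws-into (suc m) L {R} {cap} {es} {v} {i} w L<v R<v last 0<v v<i room = begin
  fillFrom (suc i) (Ws m ++ w) (putBelow (maxActive (L ++ (cap , es) ∷ R)) i (L ++ (cap , es) ∷ R))
    ≡⟨ cong (λ k → fillFrom (suc i) (Ws m ++ w) (putBelow k i (L ++ (cap , es) ∷ R))) (maxActive-unique L L<v R<v bot) ⟩
  fillFrom (suc i) (Ws m ++ w) (putBelow v i (L ++ (cap , es) ∷ R))
    ≡⟨ cong (fillFrom (suc i) (Ws m ++ w)) (putBelow-unique L L<v 0<v bot) ⟩
  fillFrom (suc i) (Ws m ++ w) (L ++ (cap , es ++ [ i ]) ∷ R)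
    ≡⟨ fillFrom-Ws-into m L w (All.map (λ b<v → <-trans b<v v<i) L<v) (All.map (λ b<v → <-trans b<v v<i) R<v)
         (lastEntry-snoc es i) (≤-<-trans z≤n v<i) (n<1+n i) room' ⟩
  fillFrom (suc i + m) w (L ++ (cap , (es ++ [ i ]) ++ consecutive (suc i) m) ∷ R)
    ≡⟨ cong₂ (λ j es' → fillFrom j w (L ++ (cap , es') ∷ R)) (sym (+-suc i m)) (++-assoc es [ i ] _) ⟩
  fillFrom (i + suc m) w (L ++ (cap , es ++ consecutive i (suc m)) ∷ R)
    ∎
  where
  open ≡-Reasoning
  room' : length (es ++ [ i ]) + m ≤ cap
  room' = subst (_≤ cap) (sym (trans (cong (_+ m) (length-++ es)) (+-assoc (length es) 1 m))) room
  bot : activeBottom (cap , es) ≡ v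
  bot = activeBottom-active es (≤-trans (s≤s (m≤m+n (length es) m)) (subst (_≤ cap) (+-suc (length es) m) room)) last

-- η_*(S^a W^x S^b W^y S^c) for y ≤ b, and for y = b + suc t, when the last suc t
-- letters of the second W-run overflow into column 1.
shortTableau : ℕ → ℕ → ℕ → ℕ → ℕ → List Column
shortTableau a b c x y =
  (suc a , consecutive 1 (suc x)) ∷ (suc b , consecutive (2 + x) (suc y)) ∷ (suc c , [ 3 + x + y ]) ∷ []

longTableau : ℕ → ℕ → ℕ → ℕ → ℕ → List Column
longTableau a b c x t =
  (suc a , consecutive 1 (suc x) ++ consecutive (3 + x + b) (suc t)) ∷ (suc b , consecutive (2 + x) (suc b)) ∷
  (suc c , [ 3 + x + b + suc t ]) ∷ []

fill-short : ∀ {a b c x y} z → x ≤ a → y ≤ b →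
  fill (word3 a b c x y z) ≡ fillFrom (4 + x + y) (Ws z) (shortTableau a b c x y)
fill-short {a} {b} {c} {x} {y} z x≤a y≤b =
  trans (fillFrom-Ws-into x [] _ [] [] refl z<s (n<1+n 1) (s≤s x≤a))
        (fillFrom-Ws-into y ((suc a , consecutive 1 (suc x)) ∷ []) _
          (s≤s (activeBottom-≤ (suc a) (consecutive 1 (suc x)) (lastEntry-consecutive 1 x)) ∷ []) []
          refl z<s (n<1+n (2 + x)) (s≤s y≤b))

fill-long : ∀ {a b c x t} z → x + suc t ≤ a →
  fill (word3 a b c x (b + suc t) z) ≡ fillFrom (4 + x + b + suc t) (Ws z) (longTableau a b c x t)
fill-long {a} {b} {c} {x} {t} z room = begin
  fill (word3 a b c x (b + suc t) z)
    ≡⟨ fillFrom-Ws-into x [] _ [] [] refl z<s (n<1+n 1) (≤-trans (s≤s (m≤m+n x (suc t))) (s≤s room)) ⟩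
  fillFrom (3 + x) (Ws (b + suc t) ++ S c ∷ Ws z) (column₁ ∷ (suc b , [ 2 + x ]) ∷ [])
    ≡⟨ cong (λ w → fillFrom (3 + x) w (column₁ ∷ (suc b , [ 2 + x ]) ∷ [])) (Ws-+ b (suc t) _) ⟩
  fillFrom (3 + x) (Ws b ++ Ws (suc t) ++ S c ∷ Ws z) (column₁ ∷ (suc b , [ 2 + x ]) ∷ [])
    ≡⟨ fillFrom-Ws-into b (column₁ ∷ []) _
         (s≤s (activeBottom-≤ (suc a) (consecutive 1 (suc x)) (lastEntry-consecutive 1 x)) ∷ []) [] refl z<s
         (n<1+n (2 + x)) ≤-refl ⟩
  fillFrom (3 + x + b) (Ws (suc t) ++ S c ∷ Ws z) (column₁ ∷ column₂ ∷ [])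
    ≡⟨ fillFrom-Ws-into (suc t) [] _ [] (subst (_< suc x) (sym column₂-full) z<s ∷ []) (lastEntry-consecutive 1 x) z<s
         (s≤s (s≤s (≤-trans (n≤1+n x) (m≤m+n (suc x) b)))) room₁ ⟩
  fillFrom (3 + x + b + suc t) (S c ∷ Ws z)
    ((suc a , consecutive 1 (suc x) ++ consecutive (3 + x + b) (suc t)) ∷ column₂ ∷ [])
    ∎
  where
  open ≡-Reasoning
  column₁ column₂ : Column
  column₁ = (suc a , consecutive 1 (suc x))
  column₂ = (suc b , consecutive (2 + x) (suc b))
  column₂-full : activeBottom column₂ ≡ 0
  column₂-full = activeBottom-full (consecutive (2 + x) (suc b)) (≤-reflexive (sym (length-consecutive (2 + x) (suc b))))
  room₁ : length (consecutive 1 (suc x)) + suc t ≤ suc a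
  room₁ = subst (λ n → n + suc t ≤ suc a) (sym (length-consecutive 1 (suc x))) (s≤s room)

posIn-∉ : ∀ {v} xs → v ∉ xs → posIn v xs ≡ nothing
posIn-∉ []       _   = refl
posIn-∉ (x ∷ xs) v∉ =
  trans (if-¬T (λ v≡x → v∉ (here (≡ᵇ⇒≡ _ _ v≡x)))) (cong (Maybe.map suc) (posIn-∉ xs (v∉ ∘ there)))

posIn-++-∉ʳ : ∀ {v} xs {ys} → v ∉ ys → posIn v (xs ++ ys) ≡ posIn v xs
posIn-++-∉ʳ []       v∉ = posIn-∉ _ v∉
posIn-++-∉ʳ {v} (x ∷ xs) v∉ = cong (λ r → if v ≡ᵇ x then just 0 else Maybe.map suc r) (posIn-++-∉ʳ xs v∉)

posIn-++-∉ˡ : ∀ {v} xs {ys} → v ∉ xs → posIn v (xs ++ ys) ≡ Maybe.map (length xs +_) (posIn v ys)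
posIn-++-∉ˡ          []       _   = sym (map-id _)
posIn-++-∉ˡ {v} (x ∷ xs) {ys} v∉ = begin
  (if v ≡ᵇ x then just 0 else Maybe.map suc (posIn v (xs ++ ys)))  ≡⟨ if-¬T (λ v≡x → v∉ (here (≡ᵇ⇒≡ _ _ v≡x))) ⟩
  Maybe.map suc (posIn v (xs ++ ys))                               ≡⟨ cong (Maybe.map suc) (posIn-++-∉ˡ xs (v∉ ∘ there)) ⟩
  Maybe.map suc (Maybe.map (length xs +_) (posIn v ys))            ≡⟨ map-∘ (posIn v ys) ⟨
  Maybe.map (suc (length xs) +_) (posIn v ys)                      ∎
  where open ≡-Reasoning

posIn-consecutive : ∀ s {p n} → p < n → posIn (s + p) (consecutive s n) ≡ just p
posIn-consecutive s {zero}  {suc n} _ = if-T (≡⇒≡ᵇ (s + 0) s (+-identityʳ s))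
posIn-consecutive s {suc p} {suc n} (s≤s p<n) = begin
  (if s + suc p ≡ᵇ s then just 0 else Maybe.map suc (posIn (s + suc p) (consecutive (suc s) n)))
    ≡⟨ if-¬T (λ hit → m+1+n≢m s (≡ᵇ⇒≡ _ _ hit)) ⟩
  Maybe.map suc (posIn (s + suc p) (consecutive (suc s) n))
    ≡⟨ cong (λ v → Maybe.map suc (posIn v (consecutive (suc s) n))) (+-suc s p) ⟩
  Maybe.map suc (posIn (suc s + p) (consecutive (suc s) n))
    ≡⟨ cong (Maybe.map suc) (posIn-consecutive (suc s) p<n) ⟩
  just (suc p)
    ∎
  where open ≡-Reasoning

∈-consecutive : ∀ {v s n} → v ∈ consecutive s n → s ≤ v × v < s + n
∈-consecutive {s = s} {suc n} (here refl) = ≤-refl , m<m+n s z<s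
∈-consecutive {v} {s} {suc n} (there v∈) with ∈-consecutive v∈
... | s<v , v<s+n = <⇒≤ s<v , subst (v <_) (sym (+-suc s n)) v<s+n

ExtendsAbove : ℕ → List ℕ → List ℕ → Set
ExtendsAbove i es es' = ∃[ s ] All (i ≤_) s × es' ≡ es ++ s

ExtendsAbove-refl : ∀ {i} es → ExtendsAbove i es es
ExtendsAbove-refl es = [] , [] , sym (++-identityʳ es)

ExtendsAbove-trans : ∀ {i es es' es''} → ExtendsAbove i es es' → ExtendsAbove i es' es'' → ExtendsAbove i es es''
ExtendsAbove-trans {es = es} (s , s≥i , refl) (s' , s'≥i , refl) = s ++ s' , ++⁺ s≥i s'≥i , ++-assoc es s s'

posIn-ExtendsAbove : ∀ {i v es es'} → v < i → ExtendsAbove i es es' → posIn v es' ≡ posIn v es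
posIn-ExtendsAbove {es = es} v<i (s , s≥i , refl) = posIn-++-∉ʳ es (λ v∈s → <⇒≱ v<i (All.lookup s≥i v∈s))

ColumnsExtend : ℕ → List Column → List Column → Set
ColumnsExtend i = Pointwise (×.Pointwise _≡_ (ExtendsAbove i))

RankedExtend : ℕ → List (List ℕ × ℕ) → List (List ℕ × ℕ) → Set
RankedExtend i = Pointwise (×.Pointwise (ExtendsAbove i) _≡_)

ColumnsExtend-trans : ∀ {i T T' T''} → ColumnsExtend i T T' → ColumnsExtend i T' T'' → ColumnsExtend i T T''
ColumnsExtend-trans {i} = Pointwise.transitive (×.×-transitive {R = _≡_} {S = ExtendsAbove i} trans ExtendsAbove-trans)

putBelow-extends : ∀ {i j} m T → i ≤ j → ColumnsExtend i T (putBelow m j T)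
putBelow-extends m []               _   = []
putBelow-extends {j = j} m ((cap , es) ∷ T) i≤j with (1 ≤ᵇ m) ∧ (activeBottom (cap , es) ≡ᵇ m)
... | true  = (refl , [ j ] , i≤j ∷ [] , refl) ∷ Pointwise.refl (refl , ExtendsAbove-refl _)
... | false = (refl , ExtendsAbove-refl es) ∷ putBelow-extends m T i≤j

fillFrom-Ws-extends : ∀ {i j} m T → i ≤ j → ColumnsExtend i T (fillFrom j (Ws m) T)
fillFrom-Ws-extends zero    T _   = Pointwise.refl (refl , ExtendsAbove-refl _)
fillFrom-Ws-extends {j = j} (suc m) T i≤j =
  ColumnsExtend-trans (putBelow-extends (maxActive T) T i≤j) (fillFrom-Ws-extends m _ (≤-trans i≤j (n≤1+n j)))

rankIn-extends : ∀ {i v D D'} → v < i → RankedExtend i D D' → rankIn v D' ≡ rankIn v D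
rankIn-extends v<i []                    = refl
rankIn-extends v<i ((ext , refl) ∷ exts) =
  cong₂ (maybe _) (rankIn-extends v<i exts) (posIn-ExtendsAbove v<i ext)

TopBelow : ℕ → Column → Set
TopBelow i (_ , [])    = ⊥
TopBelow i (_ , t ∷ _) = t < i

topRanksFrom-extends : ∀ {i D D' T T'} → All (TopBelow i) T → RankedExtend i D D' → ColumnsExtend i T T' →
  topRanksFrom D' T' ≡ topRanksFrom D T
topRanksFrom-extends [] _ [] = refl
topRanksFrom-extends {T = (_ , []) ∷ _} (() ∷ _) _ _
topRanksFrom-extends {T = (_ , t ∷ _) ∷ _} (_ ∷ tops) [] ((refl , ext) ∷ exts) =
  cong (0 ∷_) (topRanksFrom-extends tops ((ext , refl) ∷ []) exts)
topRanksFrom-extends {D = D} {D'} {T = (_ , t ∷ _) ∷ _} (t<i ∷ tops) ranked@(_ ∷ _) ((refl , ext@(_ , _ , refl)) ∷ exts) =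
  cong₂ _∷_ rank (topRanksFrom-extends tops (Pointwise.++⁺ ranked ((ext , sym rank) ∷ [])) exts)
  where
  rank : fromMaybe 0 (rankIn (t ∸ 1) D') ≡ fromMaybe 0 (rankIn (t ∸ 1) D)
  rank = cong (fromMaybe 0) (rankIn-extends (≤-<-trans (m∸n≤m t 1) t<i) ranked)

topRanks-fillFrom-Ws : ∀ {i} z T → All (TopBelow i) T → topRanksFrom [] (fillFrom i (Ws z) T) ≡ topRanksFrom [] T
topRanks-fillFrom-Ws z T tops = topRanksFrom-extends tops [] (fillFrom-Ws-extends z T ≤-refl)

rankIn-here : ∀ v es {p} r D → posIn v es ≡ just p → rankIn v ((es , r) ∷ D) ≡ just (r + p)
rankIn-here v es r D found = cong (maybe (λ p → just (r + p)) (rankIn _ D)) found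

rankIn-there : ∀ v es r D → posIn v es ≡ nothing → rankIn v ((es , r) ∷ D) ≡ rankIn v D
rankIn-there v es r D absent = cong (maybe (λ p → just (r + p)) (rankIn _ D)) absent

topRanks-three : ∀ c₁ e₁ c₂ t₂ e₂ c₃ t₃ e₃ {r₂ r₃} →
  fromMaybe 0 (rankIn (t₂ ∸ 1) ((e₁ , 0) ∷ [])) ≡ r₂ →
  fromMaybe 0 (rankIn (t₃ ∸ 1) ((e₁ , 0) ∷ (t₂ ∷ e₂ , r₂) ∷ [])) ≡ r₃ →
  topRanksFrom [] ((c₁ , e₁) ∷ (c₂ , t₂ ∷ e₂) ∷ (c₃ , t₃ ∷ e₃) ∷ []) ≡ 0 ∷ r₂ ∷ r₃ ∷ []
topRanks-three _ _ _ _ _ _ _ _ refl refl = refl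

ranks-short : ∀ a b c x y → topRanksFrom [] (shortTableau a b c x y) ≡ 0 ∷ x ∷ x + y ∷ []
ranks-short a b c x y =
  topRanks-three (suc a) column₁ (suc b) (2 + x) (consecutive (3 + x) y) (suc c) (3 + x + y) [] rank₂ rank₃
  where
  column₁ column₂ : List ℕ
  column₁ = consecutive 1 (suc x)
  column₂ = consecutive (2 + x) (suc y)
  rank₂ : fromMaybe 0 (rankIn (suc x) ((column₁ , 0) ∷ [])) ≡ x
  rank₂ = cong (fromMaybe 0) (rankIn-here (suc x) column₁ 0 [] (posIn-consecutive 1 (n<1+n x)))
  below-column₁ : 2 + x + y ∉ column₁
  below-column₁ v∈ = <⇒≱ (proj₂ (∈-consecutive v∈)) (s≤s (s≤s (m≤m+n x y)))
  rank₃ : fromMaybe 0 (rankIn (2 + x + y) ((column₁ , 0) ∷ (column₂ , x) ∷ [])) ≡ x + y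
  rank₃ = cong (fromMaybe 0) (trans (rankIn-there (2 + x + y) column₁ 0 ((column₂ , x) ∷ []) (posIn-∉ column₁ below-column₁))
                                    (rankIn-here (2 + x + y) column₂ x [] (posIn-consecutive (2 + x) (n<1+n y))))

depth-short : ∀ {a b c x y} z → x ≤ a → y ≤ b → depth (word3 a b c x y z) ≡ x + (x + y)
depth-short {a} {b} {c} {x} {y} z x≤a y≤b = begin
  depth (word3 a b c x y z)                                    ≡⟨ cong (sum ∘ topRanksFrom []) (fill-short z x≤a y≤b) ⟩
  sum (topRanksFrom [] (fillFrom (4 + x + y) (Ws z) tableau))  ≡⟨ cong sum (topRanks-fillFrom-Ws z tableau tops) ⟩
  sum (topRanksFrom [] tableau)                                ≡⟨ cong sum (ranks-short a b c x y) ⟩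
  x + (x + y + 0)                                              ≡⟨ cong (x +_) (+-identityʳ (x + y)) ⟩
  x + (x + y)                                                  ∎
  where
  open ≡-Reasoning
  tableau : List Column
  tableau = shortTableau a b c x y
  tops : All (TopBelow (4 + x + y)) tableau
  tops = s≤s (s≤s z≤n) ∷ s≤s (s≤s (s≤s (≤-trans (m≤m+n x y) (n≤1+n _)))) ∷ ≤-refl ∷ []

ranks-long : ∀ a b c x t → topRanksFrom [] (longTableau a b c x t) ≡ 0 ∷ x ∷ suc x + t ∷ []
ranks-long a b c x t =
  topRanks-three (suc a) column₁ (suc b) (2 + x) (consecutive (3 + x) b) (suc c) (3 + x + b + suc t) [] rank₂ rank₃
  where
  open ≡-Reasoning
  first-run overflow column₁ : List ℕ
  first-run = consecutive 1 (suc x)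
  overflow  = consecutive (3 + x + b) (suc t)
  column₁   = first-run ++ overflow
  not-in-overflow : suc x ∉ overflow
  not-in-overflow v∈ = <⇒≱ (s≤s (s≤s (≤-trans (m≤m+n x b) (n≤1+n _)))) (proj₁ (∈-consecutive v∈))
  past-first-run : 2 + x + b + suc t ∉ first-run
  past-first-run v∈ = <⇒≱ (proj₂ (∈-consecutive v∈)) (s≤s (s≤s (≤-trans (m≤m+n x b) (m≤m+n _ _))))
  rank₂ : fromMaybe 0 (rankIn (suc x) ((column₁ , 0) ∷ [])) ≡ x
  rank₂ = cong (fromMaybe 0) (rankIn-here (suc x) column₁ 0 []
            (trans (posIn-++-∉ʳ first-run not-in-overflow) (posIn-consecutive 1 (n<1+n x))))
  position₃ : posIn (2 + x + b + suc t) column₁ ≡ just (suc x + t)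
  position₃ = begin
    posIn (2 + x + b + suc t) (first-run ++ overflow)                 ≡⟨ posIn-++-∉ˡ first-run past-first-run ⟩
    Maybe.map (length first-run +_) (posIn (2 + x + b + suc t) overflow)
      ≡⟨ cong (λ v → Maybe.map (length first-run +_) (posIn v overflow)) (+-suc (2 + x + b) t) ⟩
    Maybe.map (length first-run +_) (posIn (3 + x + b + t) overflow)
      ≡⟨ cong (Maybe.map (length first-run +_)) (posIn-consecutive (3 + x + b) (n<1+n t)) ⟩
    just (length first-run + t)                                       ≡⟨ cong (λ n → just (n + t)) (length-consecutive 1 (suc x)) ⟩
    just (suc x + t)                                                  ∎
  rank₃ : fromMaybe 0 (rankIn (2 + x + b + suc t) ((column₁ , 0) ∷ (consecutive (2 + x) (suc b) , x) ∷ [])) ≡ suc x + t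
  rank₃ = cong (fromMaybe 0) (rankIn-here (2 + x + b + suc t) column₁ 0 ((consecutive (2 + x) (suc b) , x) ∷ []) position₃)

depth-long : ∀ {a b c x t} z → x + suc t ≤ a → depth (word3 a b c x (b + suc t) z) ≡ x + (x + suc t)
depth-long {a} {b} {c} {x} {t} z room = begin
  depth (word3 a b c x (b + suc t) z)                                ≡⟨ cong (sum ∘ topRanksFrom []) (fill-long z room) ⟩
  sum (topRanksFrom [] (fillFrom (4 + x + b + suc t) (Ws z) tableau))  ≡⟨ cong sum (topRanks-fillFrom-Ws z tableau tops) ⟩
  sum (topRanksFrom [] tableau)                                      ≡⟨ cong sum (ranks-long a b c x t) ⟩
  x + (suc x + t + 0)                                                ≡⟨ cong (x +_) (trans (+-identityʳ _) (sym (+-suc x t))) ⟩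
  x + (x + suc t)                                                    ∎
  where
  open ≡-Reasoning
  tableau : List Column
  tableau = longTableau a b c x t
  tops : All (TopBelow (4 + x + b + suc t)) tableau
  tops = s≤s (s≤s z≤n) ∷ s≤s (s≤s (s≤s (≤-trans (≤-trans (m≤m+n x b) (m≤m+n _ (suc t))) (n≤1+n _))))
       ∷ ≤-refl ∷ []

θ-Properties : ℕ → ℕ → ℕ → List Letter → Set
θ-Properties a b c π =
  Dyck (a ∷ b ∷ c ∷ []) (θ a b c π) × θ a b c (θ a b c π) ≡ π ×
  area π ≡ depth (θ a b c π) × depth π ≡ area (θ a b c π)

θ-partners : ∀ {a b c π π'} → θ a b c π ≡ π' → θ a b c π' ≡ π → Dyck (a ∷ b ∷ c ∷ []) π' →
  area π ≡ depth π' → depth π ≡ area π' → θ-Properties a b c π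
θ-partners refl θπ'≡π dyck-π' area≡depth depth≡area = dyck-π' , θπ'≡π , area≡depth , depth≡area

θ-involution : ∀ {a b c π} → Shape a b c π → θ-Properties a b c π
θ-involution {a} {b} {c} (short {x} {x'} {y} {y'} x+x'≡a y+y'≡b) =
  θ-partners (θ-short (c + x' + y') x+x'≡a y+y'≡b) (θ-short (c + x + y) x'+x≡a y'+y≡b)
    (word3⇒dyck x'+x≡a θ-second-rank (trans (+-assoc c x y) (+-comm c (x + y))))
    (trans (area-word3 x y (c + x' + y') x+x'≡a second-rank) (sym (depth-short (c + x + y) x'≤a y'≤b)))
    (trans (depth-short (c + x' + y') x≤a y≤b) (sym (area-word3 x' y' (c + x + y) x'+x≡a θ-second-rank)))
  where
  x'+x≡a : x' + x ≡ a
  x'+x≡a = trans (+-comm x' x) x+x'≡a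
  y'+y≡b : y' + y ≡ b
  y'+y≡b = trans (+-comm y' y) y+y'≡b
  x≤a : x ≤ a
  x≤a = subst (x ≤_) x+x'≡a (m≤m+n x x')
  y≤b : y ≤ b
  y≤b = subst (y ≤_) y+y'≡b (m≤m+n y y')
  x'≤a : x' ≤ a
  x'≤a = subst (x' ≤_) x'+x≡a (m≤m+n x' x)
  y'≤b : y' ≤ b
  y'≤b = subst (y' ≤_) y'+y≡b (m≤m+n y' y)
  reassoc : ∀ p m n → n + (p + m) ≡ p + (m + n)
  reassoc = solve-∀
  second-rank : y + (x' + y') ≡ x' + b
  second-rank = trans (reassoc x' y' y) (cong (x' +_) y'+y≡b)
  θ-second-rank : y' + (x + y) ≡ x + b
  θ-second-rank = trans (reassoc x y y') (cong (x +_) y+y'≡b)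
θ-involution {a} {b} {c} (long {x} {t} {u} x+t+u≡a) =
  θ-partners (θ-long (c + u) x+t+u≡a) (θ-long (c + x) u+t+x≡a)
    (word3⇒dyck (first-rank u x u+t+x≡a) (second-rank x) (+-comm c x))
    (trans (area-word3 x (b + suc t) (c + u) (first-rank x u x+t+u≡a) (second-rank u))
           (trans (ranks-sum t u) (sym (depth-long (c + x) (room u x u+t+x≡a)))))
    (trans (depth-long (c + u) (room x u x+t+u≡a))
           (trans (sym (ranks-sum t x)) (sym (area-word3 u (b + suc t) (c + x) (first-rank u x u+t+x≡a) (second-rank x)))))
  where
  u+t+x≡a : u + suc t + x ≡ a
  u+t+x≡a = trans (swap u t x) x+t+u≡a
    where
    swap : ∀ u t x → u + suc t + x ≡ x + suc t + u
    swap = solve-∀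
  first-rank : ∀ m n → m + suc t + n ≡ a → m + (suc t + n) ≡ a
  first-rank m n = trans (sym (+-assoc m (suc t) n))
  room : ∀ m n → m + suc t + n ≡ a → m + suc t ≤ a
  room m n eq = subst (m + suc t ≤_) eq (m≤m+n (m + suc t) n)
  second-rank : ∀ q → b + suc t + q ≡ suc t + q + b
  second-rank q = reassoc b t q
    where
    reassoc : ∀ b t q → b + suc t + q ≡ suc t + q + b
    reassoc = solve-∀
  ranks-sum : ∀ t u → suc t + u + u ≡ u + (u + suc t)
  ranks-sum = solve-∀

proposition5p7 : (a b c : ℕ) → 1 ≤ a → 1 ≤ b → 1 ≤ c →
    ((π : List Letter) → Dyck (a ∷ b ∷ c ∷ []) π →
      ∃! _≡_ (λ (l : ℕ × ℕ) →
        proj₁ l ≤ a × proj₁ l + proj₂ l ≤ a + b ×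
        π ≡ word3 a b c (proj₁ l) (proj₂ l) (a + b + c ∸ proj₁ l ∸ proj₂ l)))
    ×
    ((π : List Letter) → Dyck (a ∷ b ∷ c ∷ []) π →
      Dyck (a ∷ b ∷ c ∷ []) (θ a b c π) ×
      θ a b c (θ a b c π) ≡ π ×
      area π ≡ depth (θ a b c π) ×
      depth π ≡ area (θ a b c π))
proposition5p7 a b c _ _ _ = (λ _ → word3-decomposition-unique) , (λ _ → θ-involution ∘ shape)
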